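{- Let $\mathcal{H}$ be a class of graphs that is $\chi$-bounded with $\chi$-binding function $f$, and let $G$ be a graph such that for every edge $e$ of $G$, the induced subgraph $G[A(e)]$ belongs to $\mathcal{H}$. Then $\chi(G) \leq \binom{\omega(G)}{2}\cdot f(\omega(G)) + \omega(G)$.
   Context: All graphs are finite, simple and undirected. $\chi$ is the chromatic number and $\omega$ the clique number. A (hereditary) class $\mathcal{H}$ of graphs is $\chi$-bounded with $\chi$-binding function $f$ if $\chi(G) \leq f(\omega(G))$ for every $G\in\mathcal{H}$. For an edge $e=uv$ of $G$, $A(e)$ denotes the set of vertices of $G$ adjacent to neither $u$ nor $v$. $G[S]$ is the subgraph induced by $S$.
   Formalization: The χ-binding function f is in addition non-decreasing (f(a) ≤ f(b) whenever a ≤ b). The statement above fails without it. -}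

module Defs where

open import Data.Nat using (ℕ; suc; _≤_)
open import Data.Fin using (Fin)
open import Data.Bool using (Bool; true; false; _∧_; not)
open import Data.List using (List; length; lookup; filterᵇ; allFin)
open import Data.Product using (Σ; _×_; _,_)
open import Relation.Binary.PropositionalEquality using (_≡_; _≢_)
open import Relation.Nullary using (¬_)
open import Function.Definitions using (Injective)

record Graph : Set where
  field
    n      : ℕ
    Adj    : Fin n → Fin n → Bool
    sym    : ∀ u v → Adj u v ≡ Adj v u
    irrefl : ∀ v → Adj v v ≡ false
open Graph public

Adjacent : (G : Graph) → Fin (n G) → Fin (n G) → Set
Adjacent G u v = Adj G u v ≡ true

induced : (G : Graph) → (Fin (n G) → Bool) → Graph
induced G S = record
  { n      = length vs
  ; Adj    = λ i j → Adj G (lookup vs i) (lookup vs j)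
  ; sym    = λ i j → sym G (lookup vs i) (lookup vs j)
  ; irrefl = λ i → irrefl G (lookup vs i)
  }
  where vs = filterᵇ S (allFin (n G))

A : (G : Graph) → Fin (n G) → Fin (n G) → (Fin (n G) → Bool)
A G u v w = not (Adj G u w) ∧ not (Adj G v w)

HasClique : Graph → ℕ → Set
HasClique G k =
  Σ (Fin k → Fin (n G)) λ c →
    Injective _≡_ _≡_ c × (∀ i j → i ≢ j → Adjacent G (c i) (c j))

IsCliqueNumber : Graph → ℕ → Set
IsCliqueNumber G w = HasClique G w × ¬ HasClique G (suc w)

Colourable : Graph → ℕ → Set
Colourable G k =
  Σ (Fin (n G) → Fin k) λ c → ∀ u v → Adjacent G u v → c u ≢ c v

ChiBounded : (Graph → Set) → (ℕ → ℕ) → Set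
ChiBounded H f = ∀ G → H G → ∀ w → IsCliqueNumber G w → Colourable G (f w)

-- χ-binding functions are (as is standard) non-decreasing.
Monotone : (ℕ → ℕ) → Set
Monotone f = ∀ {a b} → a ≤ b → f a ≤ f b

-- Fix a maximum clique c₁ … c_ω of G. A vertex adjacent to every cᵢ would
-- extend it, so each vertex x misses some cᵢ. If x misses two of them, say
-- c_a and c_b, then x ∈ A(c_a c_b); this gives (ω choose 2) sets, each
-- inducing a graph of H with clique number at most ω, so each is
-- f(ω)-colourable. Otherwise x is adjacent to all cⱼ except one cᵢ; the set Xᵢ
-- of such vertices is independent, since for an edge xy inside Xᵢ the set
-- {x, y} ∪ {cⱼ : j ≠ i} would be a clique of size ω + 1. Colour the sets
-- A(c_a c_b) with disjoint palettes of f(ω) colours and give each Xᵢ one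
-- further colour.
module Submission where

open import Defs hiding (sym)
open import Data.Nat as ℕ using (ℕ; zero; suc; _+_; _*_; _≤_; z≤n)
import Data.Nat.Properties as ℕ
open import Data.Nat.Combinatorics using (_C_; nCk+nC[k+1]≡[n+1]C[k+1]; nC1≡n)
open import Data.Fin as Fin using (Fin; zero; suc; _<_; join; combine; inject≤)
import Data.Fin.Properties as Fin
open import Data.Vec.Functional using (Vector; []; _∷_; head; tail; updateAt)
open import Data.Vec.Functional.Properties using (updateAt-updates; updateAt-minimal)
open import Data.Bool using (Bool; true; T?)
open import Data.Bool.Properties using (¬-not; T-≡) renaming (_≟_ to _≟ᵇ_)
open import Data.List using (lookup; filterᵇ; allFin)
open import Data.List.Relation.Unary.Any using (index)
open import Data.List.Relation.Unary.Any.Properties using (lookup-index)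
open import Data.List.Membership.Propositional.Properties using (∈-filter⁺; ∈-allFin)
open import Data.Product using (Σ; ∃; _×_; _,_; proj₁; proj₂)
open import Data.Sum using (_⊎_; inj₁; inj₂)
import Data.Sum.Properties as Sum
open import Data.Empty using (⊥-elim)
open import Function using (_∘_; const; Equivalence)
open import Function.Definitions using (Injective)
open import Relation.Binary.Definitions using (tri<; tri≈; tri>)
open import Relation.Binary.PropositionalEquality
  using (_≡_; _≢_; refl; sym; trans; cong; cong₂; subst; subst₂; _≗_; module ≡-Reasoning)
open import Relation.Nullary using (¬_; Dec; yes; no; contradiction)
open import Relation.Nullary.Decidable using (map′; ¬?; _→-dec_)

Vertex : Graph → Set
Vertex G = Fin (n G)

Adjacent? : (G : Graph) (u v : Vertex G) → Dec (Adjacent G u v)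
Adjacent? G u v = Adj G u v ≟ᵇ true

Adjacent-sym : (G : Graph) {u v : Vertex G} → Adjacent G u v → Adjacent G v u
Adjacent-sym G {u} {v} uv = trans (Graph.sym G v u) uv

∃-Vector? : ∀ {m} k (P : Vector (Fin m) k → Set) →
  (∀ {xs ys} → xs ≗ ys → P xs → P ys) → (∀ xs → Dec (P xs)) → Dec (∃ P)
∃-Vector? zero P resp P? =
  map′ (λ p → [] , p) (λ (xs , p) → resp (λ ()) p) (P? [])
∃-Vector? (suc k) P resp P? =
  map′ (λ (x , xs , p) → x ∷ xs , p)
       (λ (xs , p) → head xs , tail xs , resp (λ { zero → refl ; (suc _) → refl }) p)
       (Fin.any? λ x → ∃-Vector? k (P ∘ (x ∷_))
          (λ eq → resp λ { zero → refl ; (suc i) → eq i }) (P? ∘ (x ∷_)))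

IsClique : (G : Graph) {k : ℕ} → Vector (Vertex G) k → Set
IsClique G c = ∀ i j → i ≢ j → Adjacent G (c i) (c j)

IsClique⇒HasClique : (G : Graph) {k : ℕ} {c : Vector (Vertex G) k} →
  IsClique G c → HasClique G k
IsClique⇒HasClique G {c = c} clique = c , injective , clique
  where
  injective : Injective _≡_ _≡_ c
  injective {i} {j} cᵢ≡cⱼ with i Fin.≟ j
  ... | yes i≡j = i≡j
  ... | no i≢j  with () ← trans (sym (Graph.irrefl G (c i)))
    (trans (cong (Adj G (c i)) cᵢ≡cⱼ) (clique i j i≢j))

HasClique? : (G : Graph) (k : ℕ) → Dec (HasClique G k)
HasClique? G k = map′ (IsClique⇒HasClique G ∘ proj₂) (λ (c , _ , clique) → c , clique)
  (∃-Vector? k (IsClique G) resp (λ c → Fin.all? λ i → Fin.all? λ j →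
    ¬? (i Fin.≟ j) →-dec Adjacent? G (c i) (c j)))
  where
  resp : ∀ {c d} → c ≗ d → IsClique G c → IsClique G d
  resp c≗d clique i j i≢j = subst₂ (Adjacent G) (c≗d i) (c≗d j) (clique i j i≢j)

HasClique-0 : (G : Graph) → HasClique G 0
HasClique-0 G = [] , (λ {i} → ⊥-elim (Fin.¬Fin0 i)) , λ ()

cliqueNumber-≤ : (G : Graph) (m : ℕ) → ¬ HasClique G (suc m) →
  ∃ λ w → w ≤ m × IsCliqueNumber G w
cliqueNumber-≤ G zero no-clique = 0 , z≤n , HasClique-0 G , no-clique
cliqueNumber-≤ G (suc m) no-clique with HasClique? G (suc m)
... | yes clique = suc m , ℕ.≤-refl , clique , no-clique
... | no  none   with cliqueNumber-≤ G m none
...   | w , w≤m , ω = w , ℕ.m≤n⇒m≤1+n w≤m , ω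

∷-clique : (G : Graph) {k : ℕ} {c : Vector (Vertex G) k} {x : Vertex G} →
  IsClique G c → (∀ i → Adjacent G x (c i)) → IsClique G (x ∷ c)
∷-clique G clique x~c zero    zero    0≢0 = contradiction refl 0≢0
∷-clique G clique x~c zero    (suc j) _   = x~c j
∷-clique G clique x~c (suc i) zero    _   = Adjacent-sym G (x~c i)
∷-clique G clique x~c (suc i) (suc j) i≢j = clique i j (i≢j ∘ cong suc)

updateAt-clique : (G : Graph) {k : ℕ} {c : Vector (Vertex G) k} {i : Fin k} {x : Vertex G} →
  IsClique G c → (∀ j → j ≢ i → Adjacent G x (c j)) →
  IsClique G (updateAt c i (const x))
updateAt-clique G {c = c} {i} clique x~c p q p≢q with p Fin.≟ i | q Fin.≟ i
... | yes refl | yes refl = contradiction refl p≢q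
... | yes refl | no  q≢i  = subst₂ (Adjacent G)
  (sym (updateAt-updates i c)) (sym (updateAt-minimal q i c q≢i)) (x~c q q≢i)
... | no  p≢i  | yes refl = subst₂ (Adjacent G)
  (sym (updateAt-minimal p i c p≢i)) (sym (updateAt-updates i c)) (Adjacent-sym G (x~c p p≢i))
... | no  p≢i  | no  q≢i  = subst₂ (Adjacent G)
  (sym (updateAt-minimal p i c p≢i)) (sym (updateAt-minimal q i c q≢i)) (clique p q p≢q)

Independent : (G : Graph) → (Vertex G → Set) → Set
Independent G P = ∀ x y → P x → P y → ¬ Adjacent G x y

ColouringOn : (G : Graph) → (Vertex G → Set) → ℕ → Set
ColouringOn G P k = Σ (∀ x → P x → Fin k) λ colour →
  ∀ x y (px : P x) (py : P y) → Adjacent G x y → colour x px ≢ colour y py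

ColouringOn-≤ : (G : Graph) {P : Vertex G → Set} {k l : ℕ} → k ≤ l →
  ColouringOn G P k → ColouringOn G P l
ColouringOn-≤ G k≤l (colour , proper) =
  (λ x px → inject≤ (colour x px) k≤l) ,
  λ x y px py xy → proper x y px py xy ∘ Fin.inject≤-injective k≤l k≤l _ _

module Induced (G : Graph) (S : Vertex G → Bool) where

  position : ∀ x → S x ≡ true → Vertex (induced G S)
  position x sx = index (∈-filter⁺ (T? ∘ S) (∈-allFin x) (Equivalence.from T-≡ sx))

  lookup-position : ∀ x (sx : S x ≡ true) →
    lookup (filterᵇ S (allFin (n G))) (position x sx) ≡ x
  lookup-position x sx =
    sym (lookup-index (∈-filter⁺ (T? ∘ S) (∈-allFin x) (Equivalence.from T-≡ sx)))

  induced-HasClique : ∀ {k} → HasClique (induced G S) k → HasClique G k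
  induced-HasClique (c , _ , clique) =
    IsClique⇒HasClique G {c = lookup (filterᵇ S (allFin (n G))) ∘ c} clique

  induced-colouring : ∀ {k} → Colourable (induced G S) k →
    ColouringOn G (λ x → S x ≡ true) k
  induced-colouring (colour , proper) =
    (λ x sx → colour (position x sx)) ,
    λ x y sx sy xy → proper (position x sx) (position y sy)
      (subst₂ (Adjacent G) (sym (lookup-position x sx)) (sym (lookup-position y sy)) xy)

open Induced using (induced-HasClique; induced-colouring)

ChiBounded-colouringOn : {H : Graph → Set} {f : ℕ → ℕ} → Monotone f → ChiBounded H f →
  (G : Graph) (S : Vertex G → Bool) {w : ℕ} → ¬ HasClique G (suc w) →
  H (induced G S) → ColouringOn G (λ x → S x ≡ true) (f w)
ChiBounded-colouringOn mono χ-bounded G S {w} no-clique HS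
  with cliqueNumber-≤ (induced G S) w (no-clique ∘ induced-HasClique G S)
... | w′ , w′≤w , ω = ColouringOn-≤ G (mono w′≤w)
  (induced-colouring G S (χ-bounded (induced G S) HS w′ ω))

join-injective : ∀ m n → Injective _≡_ _≡_ (join m n)
join-injective m n {s} {t} eq = begin
  s                          ≡⟨ sym (Fin.splitAt-join m n s) ⟩
  Fin.splitAt m (join m n s) ≡⟨ cong (Fin.splitAt m) eq ⟩
  Fin.splitAt m (join m n t) ≡⟨ Fin.splitAt-join m n t ⟩
  t                          ∎
  where open ≡-Reasoning

colourable-from-cover : (G : Graph) {J : Set} {p q k : ℕ}
  (X : Fin p → Vertex G → Set) (S : J → Vertex G → Set)
  (label : J → Fin q) → Injective _≡_ _≡_ label →
  (∀ i → Independent G (X i)) → (∀ j → ColouringOn G (S j) k) →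
  (∀ x → (∃ λ i → X i x) ⊎ (∃ λ j → S j x)) → Colourable G (q * k + p)
colourable-from-cover G {p = p} {q} {k} X S label label-injective
  X-independent S-colouring cover =
  (λ x → join (q * k) p (palette (cover x))) ,
  λ x y xy → palettes-differ xy (cover x) (cover y) ∘ join-injective (q * k) p
  where
  palette : ∀ {x} → (∃ λ i → X i x) ⊎ (∃ λ j → S j x) → Fin (q * k) ⊎ Fin p
  palette (inj₁ (i , _))      = inj₂ i
  palette {x} (inj₂ (j , sx)) = inj₁ (combine (label j) (proj₁ (S-colouring j) x sx))

  palettes-differ : ∀ {x y} → Adjacent G x y →
    (cx : (∃ λ i → X i x) ⊎ (∃ λ j → S j x)) (cy : (∃ λ i → X i y) ⊎ (∃ λ j → S j y)) →
    palette cx ≢ palette cy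
  palettes-differ xy (inj₁ _) (inj₂ _) ()
  palettes-differ xy (inj₂ _) (inj₁ _) ()
  palettes-differ {x} {y} xy (inj₁ (i , xi)) (inj₁ (i′ , yi′)) refl =
    X-independent i x y xi yi′ xy
  palettes-differ xy (inj₂ (j , sx)) (inj₂ (j′ , sy)) eq
    with Fin.combine-injective _ _ _ _ (Sum.inj₁-injective eq)
  ... | same-label , same-colour with label-injective same-label
  ...   | refl = proj₂ (S-colouring j) _ _ sx sy xy same-colour

OrderedPair : ℕ → Set
OrderedPair m = Σ (Fin m × Fin m) λ (a , b) → a < b

pairs : ℕ → ℕ
pairs zero    = 0
pairs (suc m) = m + pairs m

pairs≡C2 : ∀ m → pairs m ≡ m C 2
pairs≡C2 zero    = refl
pairs≡C2 (suc m) = begin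
  m + pairs m   ≡⟨ cong₂ _+_ (sym (nC1≡n m)) (pairs≡C2 m) ⟩
  m C 1 + m C 2 ≡⟨ nCk+nC[k+1]≡[n+1]C[k+1] m 1 ⟩
  suc m C 2     ∎
  where open ≡-Reasoning

pairIndex : ∀ {m} → OrderedPair m → Fin (pairs m)
pairIndex {suc m} ((zero  , suc b) , _)         = join m (pairs m) (inj₁ b)
pairIndex {suc m} ((suc a , suc b) , ℕ.s≤s a<b) =
  join m (pairs m) (inj₂ (pairIndex ((a , b) , a<b)))

pairIndex-injective : ∀ {m} → Injective _≡_ _≡_ (pairIndex {m})
pairIndex-injective {suc m} {(zero , suc b) , ℕ.s≤s z≤n} {(zero , suc b′) , ℕ.s≤s z≤n} eq
  with refl ← join-injective m (pairs m) {inj₁ b} {inj₁ b′} eq = refl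
pairIndex-injective {suc m} {(zero , suc b) , _} {(suc a′ , suc b′) , ℕ.s≤s a′<b′} eq
  with () ← join-injective m (pairs m) {inj₁ b} {inj₂ (pairIndex ((a′ , b′) , a′<b′))} eq
pairIndex-injective {suc m} {(suc a , suc b) , ℕ.s≤s a<b} {(zero , suc b′) , _} eq
  with () ← join-injective m (pairs m) {inj₂ (pairIndex ((a , b) , a<b))} {inj₁ b′} eq
pairIndex-injective {suc m} {(suc a , suc b) , ℕ.s≤s a<b} {(suc a′ , suc b′) , ℕ.s≤s a′<b′} eq
  with refl ← pairIndex-injective {x = (a , b) , a<b} {y = (a′ , b′) , a′<b′}
    (Sum.inj₂-injective (join-injective m (pairs m)
      {inj₂ (pairIndex ((a , b) , a<b))} {inj₂ (pairIndex ((a′ , b′) , a′<b′))} eq)) = refl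

∈A : (G : Graph) {u v x : Vertex G} → ¬ Adjacent G x u → ¬ Adjacent G x v → A G u v x ≡ true
∈A G {u} {v} {x} x≁u x≁v
  rewrite ¬-not (x≁u ∘ Adjacent-sym G) | ¬-not (x≁v ∘ Adjacent-sym G) = refl

module MaximumClique (G : Graph) {w : ℕ} (c : Vector (Vertex G) w)
  (clique : IsClique G c) (maximum : ¬ HasClique G (suc w)) where

  AdjacentToAllBut : Fin w → Vertex G → Set
  AdjacentToAllBut i x = ∀ j → j ≢ i → Adjacent G x (c j)

  InA : OrderedPair w → Vertex G → Set
  InA ((a , b) , _) x = A G (c a) (c b) x ≡ true

  AdjacentToAllBut-independent : ∀ i → Independent G (AdjacentToAllBut i)
  AdjacentToAllBut-independent i x y x~c y~c xy = maximum (IsClique⇒HasClique G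
    (∷-clique G (updateAt-clique G clique x~c) y~c′))
    where
    y~c′ : ∀ j → Adjacent G y (updateAt c i (const x) j)
    y~c′ j with j Fin.≟ i
    ... | yes refl = subst (Adjacent G y) (sym (updateAt-updates i c)) (Adjacent-sym G xy)
    ... | no  j≢i  = subst (Adjacent G y) (sym (updateAt-minimal j i c j≢i)) (y~c j j≢i)

  nonadjacent-pair : ∀ {x i j} → i ≢ j → ¬ Adjacent G x (c i) → ¬ Adjacent G x (c j) →
    ∃ λ p → InA p x
  nonadjacent-pair {x} {i} {j} i≢j x≁cᵢ x≁cⱼ with Fin.<-cmp i j
  ... | tri< i<j _ _ = ((i , j) , i<j) , ∈A G x≁cᵢ x≁cⱼ
  ... | tri≈ _ i≡j _ = contradiction i≡j i≢j
  ... | tri> _ _ j<i = ((j , i) , j<i) , ∈A G x≁cⱼ x≁cᵢ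

  cover : ∀ x → (∃ λ i → AdjacentToAllBut i x) ⊎ (∃ λ p → InA p x)
  cover x with Fin.all? (λ i → Adjacent? G x (c i))
  ... | yes x~c = contradiction (IsClique⇒HasClique G (∷-clique G clique x~c)) maximum
  ... | no ¬x~c with Fin.¬∀⟶∃¬ w _ (λ i → Adjacent? G x (c i)) ¬x~c
  ...   | i , x≁cᵢ with Fin.all? (λ j → ¬? (j Fin.≟ i) →-dec Adjacent? G x (c j))
  ...     | yes x~c′ = inj₁ (i , x~c′)
  ...     | no ¬x~c′ with Fin.¬∀⟶∃¬ w _ (λ j → ¬? (j Fin.≟ i) →-dec Adjacent? G x (c j)) ¬x~c′
  ...       | j , ¬[j≢i→x~cⱼ] = inj₂ (nonadjacent-pair
    (λ i≡j → ¬[j≢i→x~cⱼ] λ j≢i → contradiction (sym i≡j) j≢i)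
    x≁cᵢ (¬[j≢i→x~cⱼ] ∘ const))

theorem4p1 : (H : Graph → Set) (f : ℕ → ℕ) → Monotone f → ChiBounded H f →
    (G : Graph) →
    (∀ u v → Adjacent G u v → H (induced G (A G u v))) →
    ∀ w → IsCliqueNumber G w → Colourable G ((w C 2) * f w + w)
theorem4p1 H f mono χ-bounded G A-in-H w ((c , _ , clique) , maximum) =
  subst (λ q → Colourable G (q * f w + w)) (pairs≡C2 w)
    (colourable-from-cover G AdjacentToAllBut InA pairIndex pairIndex-injective
      AdjacentToAllBut-independent InA-colouring cover)
  where
  open MaximumClique G c clique maximum

  InA-colouring : ∀ p → ColouringOn G (InA p) (f w)
  InA-colouring ((a , b) , a<b) =
    ChiBounded-colouringOn mono χ-bounded G (A G (c a) (c b)) maximum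
      (A-in-H (c a) (c b) (clique a b (λ { refl → Fin.<-irrefl refl a<b })))
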